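{- For rational $\delta\in(0,1]$ let $e(\delta)$ be the least integer $e$ with $2^{ -e}<\delta$, and let $g(m,\delta)=(m-1)e(\delta)+\frac{(m-1)m}{2}$. Define, for $x,k,i\in\mathbb{N}$ with $k\ge1$, $\bar g(x,k,0)=x+k+1$ and $\bar g(x,k,i+1)=g(\bar g(x,k,i),1/k)$. Then for each $i\in\mathbb{N}$: (i) $\bar g(x,k,i)\le (x+k+i+1)^{2^i}$ for all $x\ge k>0$; (ii) for every $k\ge1$ and every nonempty finite $X\subseteq\mathbb{N}$, if $|X|>\bar g(\min X,k,i)$ then $X$ is $(\omega,k,i)$-persistent.
   Context: Strings are finite binary sequences; $\preceq$ is initial segment, $\tau$ extends $\sigma$ if $\sigma\preceq\tau$, incompatible means neither is an initial segment of the other; $2^i$ is the set of strings of length $i$; a tree is a set of strings closed under initial segments; a leaf is a node with no proper extension in the tree. For finite $X=\{x_0<\dots<x_n\}$, a finite tree $T$ is $X$-quasistrong if $T\cap 2^{x_i}\ne\emptyset$ for all $i\le n$ and for each $i<n$ every $\sigma\in T\cap 2^{x_i}$ has exactly two incompatible extensions in $T\cap 2^{x_{i+1}}$. A nonempty finite $X$ is $\omega$-large if $|X|>\min X$. $X$ is $(\omega,k,0)$-persistent if it is $\omega$-large; for $i\ge1$, $X$ is $(\omega,k,i)$-persistent if $X$ contains an $(\omega,k,i-1)$-persistent subset $Y$ such that for every $X$-quasistrong tree $T$ and every $C:T\cap 2^{\max X}\to\{0,\dots,k-1\}$ there exist $c<k$ and a $Y$-quasistrong finite tree $S\subseteq T$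 every leaf of which has an extension in $C^{ -1}(c)$. -}

module Defs where

open import Data.Nat using (ℕ; zero; suc; _+_; _*_; _∸_; _^_; _<_; _<ᵇ_; _⊓_; _⊔_)
open import Data.Nat.DivMod using (_/_)
open import Data.Bool using (Bool; if_then_else_)
open import Data.Fin using (Fin)
open import Data.List using (List; []; _∷_; _++_; length; foldr)
open import Data.List.Membership.Propositional using (_∈_)
open import Data.List.Relation.Unary.Linked using (Linked)
open import Data.Product using (Σ; ∃; _×_)
open import Data.Sum using (_⊎_)
open import Data.Empty using (⊥)
open import Relation.Nullary using (¬_)
open import Relation.Binary.PropositionalEquality using (_≡_)

eSearch : ℕ → ℕ → ℕ → ℕ
eSearch zero    k e = e
eSearch (suc f) k e = if k <ᵇ 2 ^ e then e else eSearch f k (suc e)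

-- e(1/k): the least e with 2^{-e} < 1/k, i.e. with k < 2^e
-- (fuel suc k suffices since k < 2^k).
e-inv : ℕ → ℕ
e-inv k = eSearch (suc k) k 0

-- g(m, δ) = (m-1) e(δ) + (m-1)m/2, given e = e(δ)
g : ℕ → ℕ → ℕ
g m e = (m ∸ 1) * e + ((m ∸ 1) * m) / 2

gbar : ℕ → ℕ → ℕ → ℕ
gbar x k zero    = x + k + 1
gbar x k (suc i) = g (gbar x k i) (e-inv k)

-- Finite sets of naturals: strictly increasing lists x₀ < … < xₙ

Increasing : List ℕ → Set
Increasing = Linked _<_

minL : List ℕ → ℕ
minL []       = 0
minL (x ∷ xs) = foldr _⊓_ x xs

maxL : List ℕ → ℕ
maxL []       = 0
maxL (x ∷ xs) = foldr _⊔_ x xs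

_⊆ℕ_ : List ℕ → List ℕ → Set
Y ⊆ℕ X = ∀ {y} → y ∈ Y → y ∈ X

Consecutive : List ℕ → ℕ → ℕ → Set
Consecutive X a b = Σ (List ℕ) λ pre → Σ (List ℕ) λ post → X ≡ pre ++ (a ∷ b ∷ post)

Str : Set
Str = List Bool

_⪯_ : Str → Str → Set
σ ⪯ τ = Σ Str λ ρ → σ ++ ρ ≡ τ

Incompatible : Str → Str → Set
Incompatible σ τ = ¬ (σ ⪯ τ) × ¬ (τ ⪯ σ)

StrSet : Set
StrSet = List Str

_⊆ₛ_ : StrSet → StrSet → Set
S ⊆ₛ T = ∀ {σ} → σ ∈ S → σ ∈ T

IsTree : StrSet → Set
IsTree T = ∀ {σ τ} → σ ∈ T → τ ⪯ σ → τ ∈ T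

IsLeaf : StrSet → Str → Set
IsLeaf T σ = σ ∈ T × (∀ {τ} → τ ∈ T → σ ⪯ τ → τ ≡ σ)

TwoExt : StrSet → ℕ → Str → Set
TwoExt T n σ =
  Σ Str λ τ₁ → Σ Str λ τ₂ →
    (τ₁ ∈ T × length τ₁ ≡ n × σ ⪯ τ₁) ×
    (τ₂ ∈ T × length τ₂ ≡ n × σ ⪯ τ₂) ×
    Incompatible τ₁ τ₂ ×
    (∀ {τ} → τ ∈ T → length τ ≡ n → σ ⪯ τ → τ ≡ τ₁ ⊎ τ ≡ τ₂)

QuasiStrong : List ℕ → StrSet → Set
QuasiStrong [] T = ⊥
QuasiStrong X@(_ ∷ _) T =
  IsTree T ×
  (∀ {x} → x ∈ X → ∃ λ σ → σ ∈ T × length σ ≡ x) ×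
  (∀ {a b} → Consecutive X a b →
     ∀ {σ} → σ ∈ T → length σ ≡ a → TwoExt T b σ)

ωLarge : List ℕ → Set
ωLarge []         = ⊥
ωLarge X@(_ ∷ _) = minL X < length X

-- colourings C : T ∩ 2^{max X} → {0,…,k-1} are represented as total
-- functions Str → Fin k (only their values on T ∩ 2^{max X} matter).
Persistent : ℕ → ℕ → List ℕ → Set
Persistent k zero    X = ωLarge X
Persistent k (suc i) X =
  Σ (List ℕ) λ Y → Increasing Y × Y ⊆ℕ X × Persistent k i Y ×
    (∀ (T : StrSet) → QuasiStrong X T → (C : Str → Fin k) →
       Σ (Fin k) λ c → Σ StrSet λ S →
         S ⊆ₛ T × QuasiStrong Y S ×
         (∀ {σ} → IsLeaf S σ →
            ∃ λ τ → τ ∈ T × length τ ≡ maxL X × σ ⪯ τ × C τ ≡ c))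

-- Part (i) is arithmetic: g(m, 1/k) ≤ m² as soon as m > 2·e(1/k), and e(1/k) ≤ k ≤ x.
--
-- For the step let m = ḡ(min X, k, i), e = e(1/k) and let Y
-- consist of every e-th element of X, m + 1 of them; this fits because m·e ≤ g(m, 1/k) < |X|,
-- and Y is (ω,k,i)-persistent by induction. In an X-quasistrong tree T, a node on a level of Y
-- has 2^e > k distinct descendants on the next level of Y. Building recursively, below each of
-- them, a tree along the rest of Y all of whose leaves extend into a single colour class, the
-- pigeonhole principle yields two descendants with the same colour, and these two form the
-- fork at the node. The prefix closure of the resulting binary tree is Y-quasistrong.

module Submission where

open import Defs
open import Data.Nat using (ℕ; zero; suc; _+_; _*_; _∸_; _^_; _≤_; _<_; _<ᵇ_; _⊓_; _⊔_; z≤n; s≤s)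
open import Data.Nat.Properties
open import Data.Nat.DivMod using (_/_; m/n*n≤m; m*n/n≡m; /-monoˡ-≤)
open import Data.Bool using (true; false) renaming (T to IsTrue)
open import Data.Unit using (tt)
open import Data.Empty using (⊥; ⊥-elim)
open import Data.Fin using (Fin; combine; remQuot) renaming (_<_ to _<ᶠ_)
open import Data.Fin.Patterns using (0F; 1F)
open import Data.Fin.Properties using (combine-remQuot; pigeonhole) renaming (<⇒≢ to <ᶠ⇒≢)
open import Data.Vec using (Vec; []; _∷_)
import Data.Vec.Properties as Vec
open import Data.List using (List; []; _∷_; _++_; length; foldr; map; drop; take)
open import Data.List.Properties using (++-identityʳ; ++-assoc; length-++; ∷-injective; take++drop≡id)
open import Data.List.Membership.Propositional using (_∈_)
open import Data.List.Membership.Propositional.Properties using (∈-++⁺ˡ; ∈-++⁺ʳ; ∈-++⁻; ∈-map⁺; ∈-map⁻)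
open import Data.List.Relation.Unary.Any using (here; there)
open import Data.List.Relation.Unary.All as All using (All; []; _∷_)
import Data.List.Relation.Unary.All.Properties as All
open import Data.List.Relation.Unary.AllPairs using (AllPairs; []; _∷_)
import Data.List.Relation.Unary.AllPairs.Properties as AllPairs
open import Data.List.Relation.Unary.Linked using ([]; [-]; _∷_)
open import Data.List.Relation.Unary.Linked.Properties using (Linked⇒AllPairs; AllPairs⇒Linked)
open import Data.Product using (Σ; ∃; _×_; _,_; proj₁; proj₂; uncurry)
open import Data.Sum as Sum using (_⊎_; inj₁; inj₂)
open import Function using (_∘_; id)
open import Relation.Nullary using (¬_)
open import Relation.Binary.PropositionalEquality

⪯-refl : ∀ {σ} → σ ⪯ σ
⪯-refl {σ} = [] , ++-identityʳ σ

⪯-trans : ∀ {ρ σ τ} → ρ ⪯ σ → σ ⪯ τ → ρ ⪯ τ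
⪯-trans {ρ} (α , refl) (β , refl) = α ++ β , sym (++-assoc ρ α β)

[]⪯ : ∀ {σ} → [] ⪯ σ
[]⪯ {σ} = σ , refl

∷⪯∷⁺ : ∀ {b σ τ} → σ ⪯ τ → (b ∷ σ) ⪯ (b ∷ τ)
∷⪯∷⁺ (ρ , refl) = ρ , refl

∷⪯∷⁻ : ∀ {a b σ τ} → (a ∷ σ) ⪯ (b ∷ τ) → a ≡ b × σ ⪯ τ
∷⪯∷⁻ (ρ , refl) = refl , ρ , refl

⪯-length : ∀ {σ τ} → σ ⪯ τ → length σ ≤ length τ
⪯-length {σ} (ρ , refl) = subst (length σ ≤_) (sym (length-++ σ)) (m≤m+n (length σ) (length ρ))

⪯-≤-length⇒≡ : ∀ {σ τ} → σ ⪯ τ → length τ ≤ length σ → σ ≡ τ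
⪯-≤-length⇒≡ {σ} ([]    , refl) _ = sym (++-identityʳ σ)
⪯-≤-length⇒≡ {σ} (_ ∷ _ , refl) h = ⊥-elim (m+1+n≰m (length σ) (subst (_≤ length σ) (length-++ σ) h))

⪯-connex : ∀ {α β γ} → α ⪯ γ → β ⪯ γ → α ⪯ β ⊎ β ⪯ α
⪯-connex {[]}                        _       _ = inj₁ []⪯
⪯-connex {_ ∷ _} {[]}                _       _ = inj₂ []⪯
⪯-connex {_ ∷ _} {_ ∷ _} {[]}        (_ , ()) _
⪯-connex {_ ∷ _} {_ ∷ _} {_ ∷ _}     p       q with ∷⪯∷⁻ p | ∷⪯∷⁻ q
... | refl , p′ | refl , q′ = Sum.map ∷⪯∷⁺ ∷⪯∷⁺ (⪯-connex p′ q′)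

⪯-unique-at-length : ∀ {α β γ} → α ⪯ γ → β ⪯ γ → length α ≡ length β → α ≡ β
⪯-unique-at-length p q eq with ⪯-connex p q
... | inj₁ α⪯β = ⪯-≤-length⇒≡ α⪯β (≤-reflexive (sym eq))
... | inj₂ β⪯α = sym (⪯-≤-length⇒≡ β⪯α (≤-reflexive eq))

≢⇒incompatible : ∀ {σ τ} → σ ≢ τ → length σ ≡ length τ → Incompatible σ τ
≢⇒incompatible σ≢τ eq =
  (λ σ⪯τ → σ≢τ (⪯-≤-length⇒≡ σ⪯τ (≤-reflexive (sym eq)))) ,
  (λ τ⪯σ → σ≢τ (sym (⪯-≤-length⇒≡ τ⪯σ (≤-reflexive eq))))

prefixes : Str → StrSet
prefixes []      = [] ∷ []
prefixes (b ∷ σ) = [] ∷ map (b ∷_) (prefixes σ)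

∈-prefixes⁻ : ∀ {ρ} σ → ρ ∈ prefixes σ → ρ ⪯ σ
∈-prefixes⁻ []      (here refl) = []⪯
∈-prefixes⁻ (b ∷ σ) (here refl) = []⪯
∈-prefixes⁻ (b ∷ σ) (there ρ∈) with ∈-map⁻ (b ∷_) ρ∈
... | _ , ρ′∈ , refl = ∷⪯∷⁺ (∈-prefixes⁻ σ ρ′∈)

∈-prefixes⁺ : ∀ {ρ σ} → ρ ⪯ σ → ρ ∈ prefixes σ
∈-prefixes⁺ {[]}    {[]}    _ = here refl
∈-prefixes⁺ {[]}    {_ ∷ _} _ = here refl
∈-prefixes⁺ {_ ∷ _} {[]}    (_ , ())
∈-prefixes⁺ {_ ∷ _} {_ ∷ _} p with ∷⪯∷⁻ p
... | refl , p′ = there (∈-map⁺ _ (∈-prefixes⁺ p′))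

≢⇒injective₂ : ∀ {A : Set} (f : Fin 2 → A) → f 0F ≢ f 1F → ∀ {β β′} → f β ≡ f β′ → β ≡ β′
≢⇒injective₂ f _   {0F} {0F} _  = refl
≢⇒injective₂ f _   {1F} {1F} _  = refl
≢⇒injective₂ f f≢ {0F} {1F} eq = ⊥-elim (f≢ eq)
≢⇒injective₂ f f≢ {1F} {0F} eq = ⊥-elim (f≢ (sym eq))

consecutive-[] : ∀ {a b} → ¬ Consecutive [] a b
consecutive-[] ([]    , _ , ())
consecutive-[] (_ ∷ _ , _ , ())

consecutive-singleton : ∀ {x a b} → ¬ Consecutive (x ∷ []) a b
consecutive-singleton ([]      , _    , ())
consecutive-singleton (_ ∷ pre , post , eq) = consecutive-[] (pre , post , proj₂ (∷-injective eq))

consecutive-∷⁻ : ∀ {x X a b} → Consecutive (x ∷ X) a b →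
  (x ≡ a × ∃ λ post → X ≡ b ∷ post) ⊎ Consecutive X a b
consecutive-∷⁻ ([]      , post , refl) = inj₁ (refl , post , refl)
consecutive-∷⁻ (_ ∷ pre , post , eq)   with ∷-injective eq
... | refl , eq′ = inj₂ (pre , post , eq′)

consecutive-++ : ∀ pre {X a b} → Consecutive X a b → Consecutive (pre ++ X) a b
consecutive-++ pre (pre′ , post , refl) = pre ++ pre′ , post , sym (++-assoc pre pre′ _)

consecutive-∈ : ∀ {X a b} → Consecutive X a b → a ∈ X × b ∈ X
consecutive-∈ (pre , _ , refl) = ∈-++⁺ʳ pre (here refl) , ∈-++⁺ʳ pre (there (here refl))

SuffixOf : List ℕ → List ℕ → Set
SuffixOf Z X = Σ (List ℕ) λ pre → X ≡ pre ++ Z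

drop-suffixOf : ∀ d {Z X} → SuffixOf Z X → SuffixOf (drop d Z) X
drop-suffixOf d {Z} (pre , refl) =
  pre ++ take d Z , trans (cong (pre ++_) (sym (take++drop≡id d Z))) (sym (++-assoc pre (take d Z) _))

suffixOf-∈ : ∀ {Z X z} → SuffixOf Z X → z ∈ Z → z ∈ X
suffixOf-∈ (pre , refl) = ∈-++⁺ʳ pre

<-length-drop : ∀ d {n} (Z : List ℕ) → d + n < length Z → n < length (drop d Z)
<-length-drop zero    Z       h       = h
<-length-drop (suc d) (_ ∷ Z) (s≤s h) = <-length-drop d Z h

head<all : ∀ {x X} → Increasing (x ∷ X) → All (x <_) X
head<all inc with Linked⇒AllPairs <-trans inc
... | x<X ∷ _ = x<X

head≤∈ : ∀ {x X a} → Increasing (x ∷ X) → a ∈ x ∷ X → x ≤ a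
head≤∈ inc (here refl) = ≤-refl
head≤∈ inc (there a∈)  = <⇒≤ (All.lookup (head<all inc) a∈)

increasing-tail : ∀ {x X} → Increasing (x ∷ X) → Increasing X
increasing-tail [-]       = []
increasing-tail (_ ∷ inc) = inc

minL-increasing : ∀ {x X} → Increasing (x ∷ X) → minL (x ∷ X) ≡ x
minL-increasing inc = foldr-⊓-≥ (All.map <⇒≤ (head<all inc))
  where
    foldr-⊓-≥ : ∀ {x X} → All (x ≤_) X → foldr _⊓_ x X ≡ x
    foldr-⊓-≥ []          = refl
    foldr-⊓-≥ (x≤y ∷ x≤X) = trans (cong (_ ⊓_) (foldr-⊓-≥ x≤X)) (m≥n⇒m⊓n≡n x≤y)

foldr-⊔ : ∀ x X → foldr _⊔_ x X ≡ x ⊔ foldr _⊔_ 0 X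
foldr-⊔ x []      = sym (⊔-identityʳ x)
foldr-⊔ x (y ∷ X) = begin
  y ⊔ foldr _⊔_ x X  ≡⟨ cong (y ⊔_) (foldr-⊔ x X) ⟩
  y ⊔ (x ⊔ M)        ≡⟨ ⊔-assoc y x M ⟨
  (y ⊔ x) ⊔ M        ≡⟨ cong (_⊔ M) (⊔-comm y x) ⟩
  (x ⊔ y) ⊔ M        ≡⟨ ⊔-assoc x y M ⟩
  x ⊔ (y ⊔ M)        ∎
  where
    open ≡-Reasoning
    M : ℕ
    M = foldr _⊔_ 0 X

maxL-∷ : ∀ {x y Y} → x ≤ y → maxL (x ∷ y ∷ Y) ≡ maxL (y ∷ Y)
maxL-∷ {x} {y} {Y} x≤y = begin
  y ⊔ foldr _⊔_ x Y  ≡⟨ cong (y ⊔_) (foldr-⊔ x Y) ⟩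
  y ⊔ (x ⊔ M)        ≡⟨ ⊔-assoc y x M ⟨
  (y ⊔ x) ⊔ M        ≡⟨ cong (_⊔ M) (m≥n⇒m⊔n≡m x≤y) ⟩
  y ⊔ M              ≡⟨ foldr-⊔ y Y ⟨
  foldr _⊔_ y Y      ∎
  where
    open ≡-Reasoning
    M : ℕ
    M = foldr _⊔_ 0 Y

Splits : List ℕ → StrSet → Set
Splits X T = ∀ {a b} → Consecutive X a b → ∀ {σ} → σ ∈ T → length σ ≡ a → TwoExt T b σ

splits-suffixOf : ∀ {Z X T} → SuffixOf Z X → Splits X T → Splits Z T
splits-suffixOf (pre , refl) sp c = sp (consecutive-++ pre c)

splits-∷⁻ : ∀ {x X T} → Splits (x ∷ X) T → Splits X T
splits-∷⁻ {x} = splits-suffixOf (x ∷ [] , refl)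

Extension : StrSet → ℕ → Str → Str → Set
Extension T n σ τ = τ ∈ T × length τ ≡ n × σ ⪯ τ

branch : ∀ {T n σ} → TwoExt T n σ → Fin 2 → Str
branch (τ₁ , _)     0F = τ₁
branch (_ , τ₂ , _) 1F = τ₂

branch-extension : ∀ {T n σ} (t : TwoExt T n σ) β → Extension T n σ (branch t β)
branch-extension (_ , _ , e₁ , _)     0F = e₁
branch-extension (_ , _ , _ , e₂ , _) 1F = e₂

branch-⪯-injective : ∀ {T n σ ρ} (t : TwoExt T n σ) {β β′} → branch t β ⪯ ρ → branch t β′ ⪯ ρ → β ≡ β′
branch-⪯-injective {n = n} t@(_ , _ , _ , _ , (τ₁⋠τ₂ , _) , _) {β} {β′} p p′ =
  ≢⇒injective₂ (branch t) (λ { refl → τ₁⋠τ₂ ⪯-refl })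
    (⪯-unique-at-length p p′ (trans (level β) (sym (level β′))))
  where
    level : ∀ β → length (branch t β) ≡ n
    level β = proj₁ (proj₂ (branch-extension t β))

twoExt-transfer : ∀ {T T′ n σ} → T ⊆ₛ T′ → (∀ {τ} → τ ∈ T′ → length τ ≡ n → σ ⪯ τ → τ ∈ T) →
  TwoExt T n σ → TwoExt T′ n σ
twoExt-transfer T⊆T′ back (τ₁ , τ₂ , (τ₁∈ , l₁ , p₁) , (τ₂∈ , l₂ , p₂) , inc , only) =
  τ₁ , τ₂ , (T⊆T′ τ₁∈ , l₁ , p₁) , (T⊆T′ τ₂∈ , l₂ , p₂) , inc ,
  λ τ∈ l p → only (back τ∈ l p) l p

extend-to-maxL : ∀ {X T x σ} → Increasing X → Splits X T → x ∈ X → σ ∈ T → length σ ≡ x →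
  ∃ λ τ → Extension T (maxL X) σ τ
extend-to-maxL {_ ∷ []}          _            _  (here refl) σ∈ σx = _ , σ∈ , σx , ⪯-refl
extend-to-maxL {x₀ ∷ x₁ ∷ X} {T} {σ = σ} (x₀<x₁ ∷ inc) sp x∈ σ∈ σx =
  subst (λ n → ∃ λ τ → Extension T n σ τ) (sym (maxL-∷ {Y = X} (<⇒≤ x₀<x₁))) (reach-tail x∈ σ∈ σx)
  where
    reach-tail : ∀ {x σ} → x ∈ x₀ ∷ x₁ ∷ X → σ ∈ T → length σ ≡ x → ∃ λ τ → Extension T (maxL (x₁ ∷ X)) σ τ
    reach-tail (there x∈) σ∈ σx = extend-to-maxL inc (splits-∷⁻ sp) x∈ σ∈ σx
    reach-tail (here refl) σ∈ σx
      with τ₁∈ , τ₁x , σ⪯τ₁ ← branch-extension (sp ([] , X , refl) σ∈ σx) 0F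
      with τ , τ∈ , τmax , τ₁⪯τ ← extend-to-maxL inc (splits-∷⁻ sp) (here refl) τ₁∈ τ₁x
      = τ , τ∈ , τmax , ⪯-trans σ⪯τ₁ τ₁⪯τ

OnHead : List ℕ → Str → Set
OnHead []      σ = ⊥
OnHead (x ∷ _) σ = length σ ≡ x

module _ {T : StrSet} where

  descend : ∀ {X ν} → Splits X T → ν ∈ T → OnHead X ν → ∀ {d} → d < length X → Vec (Fin 2) d →
    ∃ λ τ → τ ∈ T × OnHead (drop d X) τ × ν ⪯ τ
  descend                 _  ν∈ νX {zero}  _       []       = _ , ν∈ , νX , ⪯-refl
  descend {_ ∷ _ ∷ X} sp ν∈ νX {suc d} (s≤s d<) (β ∷ bs) =
    let τ∈ , τx , ν⪯τ    = branch-extension (sp ([] , X , refl) ν∈ νX) β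
        ρ , ρ∈ , ρX , τ⪯ρ = descend (splits-∷⁻ sp) τ∈ τx d< bs
    in ρ , ρ∈ , ρX , ⪯-trans ν⪯τ τ⪯ρ

  descend-injective : ∀ {X ν} (sp : Splits X T) (ν∈ : ν ∈ T) (νX : OnHead X ν) {d} (d< : d < length X)
    (bs bs′ : Vec (Fin 2) d) → proj₁ (descend sp ν∈ νX d< bs) ≡ proj₁ (descend sp ν∈ νX d< bs′) → bs ≡ bs′
  descend-injective _ _ _ {zero} _ [] [] _ = refl
  descend-injective {_ ∷ x′ ∷ X} {ν} sp ν∈ νX {suc d} (s≤s d<) (β ∷ bs) (β′ ∷ bs′) eq =
    same-branch (branch-⪯-injective t (below β bs) (subst (branch t β′ ⪯_) (sym eq) (below β′ bs′))) bs′ eq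
    where
      t : TwoExt T x′ ν
      t = sp ([] , X , refl) ν∈ νX
      below : ∀ β bs → branch t β ⪯ proj₁ (descend sp ν∈ νX (s≤s d<) (β ∷ bs))
      below β bs = let τ∈ , τx , _ = branch-extension t β in
        proj₂ (proj₂ (proj₂ (descend (splits-∷⁻ sp) τ∈ τx d< bs)))
      same-branch : ∀ {γ} → β ≡ γ → ∀ cs →
        proj₁ (descend sp ν∈ νX (s≤s d<) (β ∷ bs)) ≡ proj₁ (descend sp ν∈ νX (s≤s d<) (γ ∷ cs)) →
        β ∷ bs ≡ γ ∷ cs
      same-branch refl cs eq = cong (β ∷_) (descend-injective (splits-∷⁻ sp) _ _ d< bs cs eq)

address : ∀ {d} → Fin (2 ^ d) → Vec (Fin 2) d
address {zero}  _ = []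
address {suc d} i = proj₁ (remQuot {2} (2 ^ d) i) ∷ address (proj₂ (remQuot {2} (2 ^ d) i))

address-injective : ∀ {d} {i j : Fin (2 ^ d)} → address {d} i ≡ address j → i ≡ j
address-injective {zero}  {0F} {0F} _ = refl
address-injective {suc d} {i}  {j}  eq with Vec.∷-injective eq
... | β≡ , bs≡ = begin
  i                                        ≡⟨ combine-remQuot {2} (2 ^ d) i ⟨
  uncurry combine (remQuot {2} (2 ^ d) i)  ≡⟨ cong₂ combine β≡ (address-injective {d} bs≡) ⟩
  uncurry combine (remQuot {2} (2 ^ d) j)  ≡⟨ combine-remQuot {2} (2 ^ d) j ⟩
  j                                        ∎
  where open ≡-Reasoning

-- The tree S of the paper is the prefix closure `nodes` of such a splitting.
data Splitting (P : Str → Set) : List ℕ → Str → Set where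
  leaf : ∀ {y ν} → length ν ≡ y → P ν → Splitting P (y ∷ []) ν
  fork : ∀ {y ys ν} (ν′ : Fin 2 → Str) → length ν ≡ y → (∀ β → ν ⪯ ν′ β) → ν′ 0F ≢ ν′ 1F →
         (∀ β → Splitting P ys (ν′ β)) → Splitting P (y ∷ ys) ν

module _ {P : Str → Set} where

  nodes : ∀ {ys ν} → Splitting P ys ν → StrSet
  nodes (leaf {ν = ν} _ _) = prefixes ν
  nodes (fork _ _ _ _ s)   = nodes (s 0F) ++ nodes (s 1F)

  root-length : ∀ {y ys ν} → Splitting P (y ∷ ys) ν → length ν ≡ y
  root-length (leaf ν-y _)         = ν-y
  root-length (fork _ ν-y _ _ _)   = ν-y

  module _ {ys : List ℕ} {ν′ : Fin 2 → Str} (s : ∀ β → Splitting P ys (ν′ β)) where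

    ∈-nodes-fork⁺ : ∀ {σ} β → σ ∈ nodes (s β) → σ ∈ nodes (s 0F) ++ nodes (s 1F)
    ∈-nodes-fork⁺ 0F = ∈-++⁺ˡ
    ∈-nodes-fork⁺ 1F = ∈-++⁺ʳ (nodes (s 0F))

    ∈-nodes-fork⁻ : ∀ {σ} → σ ∈ nodes (s 0F) ++ nodes (s 1F) → ∃ λ β → σ ∈ nodes (s β)
    ∈-nodes-fork⁻ σ∈ with ∈-++⁻ (nodes (s 0F)) σ∈
    ... | inj₁ σ∈₀ = 0F , σ∈₀
    ... | inj₂ σ∈₁ = 1F , σ∈₁

  nodes-isTree : ∀ {ys ν} (s : Splitting P ys ν) → IsTree (nodes s)
  nodes-isTree (leaf _ _)         σ∈ ρ⪯σ = ∈-prefixes⁺ (⪯-trans ρ⪯σ (∈-prefixes⁻ _ σ∈))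
  nodes-isTree (fork _ _ _ _ s)   σ∈ ρ⪯σ with β , σ∈β ← ∈-nodes-fork⁻ s σ∈ =
    ∈-nodes-fork⁺ s β (nodes-isTree (s β) σ∈β ρ⪯σ)

  root-∈-nodes : ∀ {ys ν} (s : Splitting P ys ν) → ν ∈ nodes s
  root-∈-nodes (leaf _ _)           = ∈-prefixes⁺ ⪯-refl
  root-∈-nodes (fork _ _ ν⪯ν′ _ s) = ∈-nodes-fork⁺ s 0F (nodes-isTree (s 0F) (root-∈-nodes (s 0F)) (ν⪯ν′ 0F))

  nodes-below-leaves : ∀ {ys ν σ} (s : Splitting P ys ν) → σ ∈ nodes s → ∃ λ l → l ∈ nodes s × P l × σ ⪯ l
  nodes-below-leaves s@(leaf _ Pν) σ∈ = _ , root-∈-nodes s , Pν , ∈-prefixes⁻ _ σ∈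
  nodes-below-leaves (fork _ _ _ _ s) σ∈
    with β , σ∈β ← ∈-nodes-fork⁻ s σ∈
    with l , l∈ , Pl , σ⪯l ← nodes-below-leaves (s β) σ∈β
    = l , ∈-nodes-fork⁺ s β l∈ , Pl , σ⪯l

  nodes-comparable-root : ∀ {ys ν σ} (s : Splitting P ys ν) → σ ∈ nodes s → σ ⪯ ν ⊎ ν ⪯ σ
  nodes-comparable-root (leaf _ _) σ∈ = inj₁ (∈-prefixes⁻ _ σ∈)
  nodes-comparable-root (fork _ _ ν⪯ν′ _ s) σ∈
    with β , σ∈β ← ∈-nodes-fork⁻ s σ∈
    with nodes-comparable-root (s β) σ∈β
  ... | inj₁ σ⪯ν′ = ⪯-connex σ⪯ν′ (ν⪯ν′ β)
  ... | inj₂ ν′⪯σ = inj₂ (⪯-trans (ν⪯ν′ β) ν′⪯σ)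

  nodes-extend-root : ∀ {ys ν σ} (s : Splitting P ys ν) → σ ∈ nodes s → length ν ≤ length σ → ν ⪯ σ
  nodes-extend-root s σ∈ ν≤σ with nodes-comparable-root s σ∈
  ... | inj₁ σ⪯ν rewrite ⪯-≤-length⇒≡ σ⪯ν ν≤σ = ⪯-refl
  ... | inj₂ ν⪯σ = ν⪯σ

  fork-confines : ∀ {y ys ν′} → ν′ 0F ≢ ν′ 1F → (s : ∀ β → Splitting P (y ∷ ys) (ν′ β)) →
    ∀ {β σ τ} → σ ∈ nodes (s β) → y ≤ length σ → τ ∈ nodes (s 0F) ++ nodes (s 1F) → σ ⪯ τ → τ ∈ nodes (s β)
  fork-confines {y} {ν′ = ν′} ν′-distinct s {β} {σ} {τ} σ∈ y≤σ τ∈ σ⪯τ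
    with β′ , τ∈β′ ← ∈-nodes-fork⁻ s τ∈ =
    subst (λ γ → τ ∈ nodes (s γ)) (≢⇒injective₂ ν′ ν′-distinct ν′β′≡ν′β) τ∈β′
    where
      ν′β⪯σ : ν′ β ⪯ σ
      ν′β⪯σ = nodes-extend-root (s β) σ∈ (subst (_≤ length σ) (sym (root-length (s β))) y≤σ)
      ν′β′⪯τ : ν′ β′ ⪯ τ
      ν′β′⪯τ = nodes-extend-root (s β′) τ∈β′
        (subst (_≤ length τ) (sym (root-length (s β′))) (≤-trans y≤σ (⪯-length σ⪯τ)))
      ν′β′≡ν′β : ν′ β′ ≡ ν′ β
      ν′β′≡ν′β = ⪯-unique-at-length ν′β′⪯τ (⪯-trans ν′β⪯σ σ⪯τ)
        (trans (root-length (s β′)) (sym (root-length (s β))))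

  fork-splits-at-root : ∀ {y b post ν σ} (s : Splitting P (y ∷ b ∷ post) ν) → σ ∈ nodes s → length σ ≡ y →
    TwoExt (nodes s) b σ
  fork-splits-at-root {b = b} {ν = ν} s@(fork ν′ ν-y ν⪯ν′ ν′-distinct ss) σ∈ σ-y
    with refl ← ⪯-≤-length⇒≡ (nodes-extend-root s σ∈ (≤-reflexive (trans ν-y (sym σ-y))))
                             (≤-reflexive (trans σ-y (sym ν-y)))
    = ν′ 0F , ν′ 1F , child 0F , child 1F ,
      ≢⇒incompatible ν′-distinct (trans (root-length (ss 0F)) (sym (root-length (ss 1F)))) , only
    where
      child : ∀ β → Extension (nodes s) b ν (ν′ β)
      child β = ∈-nodes-fork⁺ ss β (root-∈-nodes (ss β)) , root-length (ss β) , ν⪯ν′ β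
      either : ∀ {τ} β → τ ≡ ν′ β → τ ≡ ν′ 0F ⊎ τ ≡ ν′ 1F
      either 0F = inj₁
      either 1F = inj₂
      only : ∀ {τ} → τ ∈ nodes s → length τ ≡ b → ν ⪯ τ → τ ≡ ν′ 0F ⊎ τ ≡ ν′ 1F
      only {τ} τ∈ τ-b _ with β , τ∈β ← ∈-nodes-fork⁻ ss τ∈ =
        either β (sym (⪯-≤-length⇒≡ ν′β⪯τ (≤-reflexive (trans τ-b (sym (root-length (ss β)))))))
        where
          ν′β⪯τ : ν′ β ⪯ τ
          ν′β⪯τ = nodes-extend-root (ss β) τ∈β (≤-reflexive (trans (root-length (ss β)) (sym τ-b)))

  nodes-splits : ∀ {ys ν} (s : Splitting P ys ν) → Increasing ys → Splits ys (nodes s)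
  nodes-splits (leaf _ _)                  _ c = ⊥-elim (consecutive-singleton c)
  nodes-splits (fork {ys = []} _ _ _ _ _)  _ c = ⊥-elim (consecutive-singleton c)
  nodes-splits s@(fork {ys = y′ ∷ _} _ _ _ ν′-distinct ss) inc c {σ} σ∈ σ-a with consecutive-∷⁻ c
  ... | inj₁ (refl , _ , refl) = fork-splits-at-root s σ∈ σ-a
  ... | inj₂ c′ with β , σ∈β ← ∈-nodes-fork⁻ ss σ∈ =
    twoExt-transfer (∈-nodes-fork⁺ ss β) (λ τ∈ _ σ⪯τ → fork-confines ν′-distinct ss σ∈β y′≤σ τ∈ σ⪯τ)
      (nodes-splits (ss β) (increasing-tail inc) c′ σ∈β σ-a)
    where
      y′≤σ : y′ ≤ length σ
      y′≤σ = subst (y′ ≤_) (sym σ-a) (head≤∈ (increasing-tail inc) (proj₁ (consecutive-∈ c′)))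

  nodes-levels : ∀ {ys ν} (s : Splitting P ys ν) → ∀ {x} → x ∈ ys → ∃ λ σ → σ ∈ nodes s × length σ ≡ x
  nodes-levels s                   (here refl) = _ , root-∈-nodes s , root-length s
  nodes-levels (fork _ _ _ _ ss)   (there x∈) with σ , σ∈ , σ-x ← nodes-levels (ss 0F) x∈ =
    σ , ∈-nodes-fork⁺ ss 0F σ∈ , σ-x

  nodes-quasiStrong : ∀ {ys ν} (s : Splitting P ys ν) → Increasing ys → QuasiStrong ys (nodes s)
  nodes-quasiStrong {_ ∷ _} s inc = nodes-isTree s , nodes-levels s , nodes-splits s inc

  nodes-⊆ : ∀ {ys ν T} (s : Splitting P ys ν) → IsTree T → (∀ {l} → P l → l ∈ T) → nodes s ⊆ₛ T
  nodes-⊆ s T-tree P⊆T σ∈ with _ , _ , Pl , σ⪯l ← nodes-below-leaves s σ∈ = T-tree (P⊆T Pl) σ⪯l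

  nodes-leaves : ∀ {ys ν σ} (s : Splitting P ys ν) → IsLeaf (nodes s) σ → P σ
  nodes-leaves s (σ∈ , maximal) with l , l∈ , Pl , σ⪯l ← nodes-below-leaves s σ∈ = subst P (maximal l∈ σ⪯l) Pl

strided : ℕ → ℕ → List ℕ → List ℕ
strided e r []      = []
strided e r (x ∷ X) = x ∷ later r
  where
    later : ℕ → List ℕ
    later zero    = []
    later (suc r) = strided e r (drop e (x ∷ X))

length-strided : ∀ e r X → r * e < length X → length (strided e r X) ≡ suc r
length-strided e zero    (x ∷ X) _ = refl
length-strided e (suc r) (x ∷ X) h = cong suc (length-strided e r (drop e (x ∷ X)) (<-length-drop e (x ∷ X) h))

All-strided : ∀ {P : ℕ → Set} e r {X} → All P X → All P (strided e r X)
All-strided e r       []              = []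
All-strided e zero    (px ∷ _)        = px ∷ []
All-strided e (suc r) pxs@(px ∷ _)    = px ∷ All-strided e r (All.drop⁺ e pxs)

strided-⊆ : ∀ e r {X} → strided e r X ⊆ℕ X
strided-⊆ e r = All.lookup (All-strided e r (All.tabulate id))

strided-increasing : ∀ {e} → 1 ≤ e → ∀ r {X} → Increasing X → Increasing (strided e r X)
strided-increasing {suc s} _ r inc = AllPairs⇒Linked (go r (Linked⇒AllPairs <-trans inc))
  where
    go : ∀ r {X} → AllPairs _<_ X → AllPairs _<_ (strided (suc s) r X)
    go r       []          = []
    go zero    (_ ∷ _)     = [] ∷ []
    go (suc r) (x<X ∷ X<)  = All-strided (suc s) r (All.drop⁺ s x<X) ∷ go r (AllPairs.drop⁺ s X<)

module _ {k} (C : Str → Fin k) {X T} (X-increasing : Increasing X) (X-splits : Splits X T) where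

  Reaches : Fin k → Str → Set
  Reaches c σ = ∃ λ τ → τ ∈ T × length τ ≡ maxL X × σ ⪯ τ × C τ ≡ c

  homogeneous-splitting : ∀ {e} → k < 2 ^ e → ∀ r Z → SuffixOf Z X → r * e < length Z →
    ∀ {ν} → ν ∈ T → OnHead Z ν → ∃ λ c → Splitting (Reaches c) (strided e r Z) ν
  homogeneous-splitting _ zero (z ∷ _) Z⊑X _ ν∈ ν-z
    with τ , τ∈ , τ-max , ν⪯τ ← extend-to-maxL X-increasing X-splits (suffixOf-∈ Z⊑X (here refl)) ν∈ ν-z
    = C τ , leaf ν-z (τ , τ∈ , τ-max , ν⪯τ , refl)
  homogeneous-splitting {e} k<2ᵉ (suc r) Z@(z ∷ _) Z⊑X r+1e<Z {ν} ν∈ ν-z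
    = colour i , fork (child ∘ pair) ν-z (ν⪯child ∘ pair) child-distinct subtree
    where
      Z-splits : Splits Z T
      Z-splits = splits-suffixOf Z⊑X X-splits
      e<Z : e < length Z
      e<Z = ≤-<-trans (m≤m+n e (r * e)) r+1e<Z
      descendant : Fin (2 ^ e) → ∃ λ τ → τ ∈ T × OnHead (drop e Z) τ × ν ⪯ τ
      descendant i = descend Z-splits ν∈ ν-z e<Z (address i)
      child : Fin (2 ^ e) → Str
      child = proj₁ ∘ descendant
      ν⪯child : ∀ i → ν ⪯ child i
      ν⪯child = proj₂ ∘ proj₂ ∘ proj₂ ∘ descendant
      below : ∀ i → ∃ λ c → Splitting (Reaches c) (strided e r (drop e Z)) (child i)
      below i = let _ , τ∈ , τ-head , _ = descendant i in
        homogeneous-splitting k<2ᵉ r (drop e Z) (drop-suffixOf e Z⊑X) (<-length-drop e Z r+1e<Z) τ∈ τ-head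
      colour : Fin (2 ^ e) → Fin k
      colour = proj₁ ∘ below
      collision : ∃ λ i → ∃ λ j → i <ᶠ j × colour i ≡ colour j
      collision = pigeonhole k<2ᵉ colour
      i j : Fin (2 ^ e)
      i = proj₁ collision
      j = proj₁ (proj₂ collision)
      i<j : i <ᶠ j
      i<j = proj₁ (proj₂ (proj₂ collision))
      same-colour : colour i ≡ colour j
      same-colour = proj₂ (proj₂ (proj₂ collision))
      pair : Fin 2 → Fin (2 ^ e)
      pair 0F = i
      pair 1F = j
      child-distinct : child i ≢ child j
      child-distinct eq =
        <ᶠ⇒≢ i<j (address-injective {e} (descend-injective Z-splits ν∈ ν-z e<Z (address i) (address j) eq))
      subtree : ∀ β → Splitting (Reaches (colour i)) (strided e r (drop e Z)) (child (pair β))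
      subtree 0F = proj₂ (below i)
      subtree 1F = subst (λ c → Splitting (Reaches c) (strided e r (drop e Z)) (child j)) (sym same-colour) (proj₂ (below j))

  homogeneous-subtree : ∀ {e m} → 1 ≤ e → k < 2 ^ e → m * e < length X →
    IsTree T → (∃ λ ν → ν ∈ T × OnHead X ν) →
    ∃ λ c → ∃ λ S → S ⊆ₛ T × QuasiStrong (strided e m X) S × (∀ {σ} → IsLeaf S σ → Reaches c σ)
  homogeneous-subtree {m = m} 1≤e k<2ᵉ me<X T-tree (ν , ν∈ , ν-head)
    with c , s ← homogeneous-splitting k<2ᵉ m X ([] , refl) me<X ν∈ ν-head
    = c , nodes s , nodes-⊆ s T-tree (λ (τ , τ∈ , _ , l⪯τ , _) → T-tree τ∈ l⪯τ) ,
      nodes-quasiStrong s (strided-increasing 1≤e m X-increasing) , nodes-leaves s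

eSearch-≥ : ∀ f k e → e ≤ eSearch f k e
eSearch-≥ zero    k e = ≤-refl
eSearch-≥ (suc f) k e with k <ᵇ 2 ^ e
... | true  = ≤-refl
... | false = ≤-trans (n≤1+n e) (eSearch-≥ f k (suc e))

eSearch-sound : ∀ f k e → k < 2 ^ (f + e) → k < 2 ^ eSearch f k e
eSearch-sound zero    k e k<2ᶠ⁺ᵉ = k<2ᶠ⁺ᵉ
eSearch-sound (suc f) k e k<2ᶠ⁺ᵉ with k <ᵇ 2 ^ e in test
... | true  = <ᵇ⇒< k (2 ^ e) (subst IsTrue (sym test) tt)
... | false = eSearch-sound f k (suc e) (subst (λ n → k < 2 ^ n) (sym (+-suc f e)) k<2ᶠ⁺ᵉ)

eSearch-minimal : ∀ f k e b → k < 2 ^ b → e ≤ b → eSearch f k e ≤ b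
eSearch-minimal zero    k e b _    e≤b = e≤b
eSearch-minimal (suc f) k e b k<2ᵇ e≤b with k <ᵇ 2 ^ e in test
... | true  = e≤b
... | false = eSearch-minimal f k (suc e) b k<2ᵇ (≤∧≢⇒< e≤b λ { refl → subst IsTrue test (<⇒<ᵇ k<2ᵇ) })

n<2^n : ∀ n → n < 2 ^ n
n<2^n zero    = s≤s z≤n
n<2^n (suc n) = +-mono-≤ (m^n>0 2 n) (≤-trans (n<2^n n) (≤-reflexive (sym (*-identityˡ (2 ^ n)))))

1≤e-inv : ∀ {k} → 1 ≤ k → 1 ≤ e-inv k
1≤e-inv {suc k} _ = eSearch-≥ (suc k) (suc k) 1

e-inv≤ : ∀ k → e-inv k ≤ k
e-inv≤ k = eSearch-minimal (suc k) k 0 k (n<2^n k) z≤n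

<2^e-inv : ∀ k → k < 2 ^ e-inv k
<2^e-inv k = eSearch-sound (suc k) k 0 (<-≤-trans (n<2^n k) (^-monoʳ-≤ 2 (≤-trans (n≤1+n k) (m≤m+n (suc k) 0))))

n≤triangle : ∀ n → n ≤ (n * suc n) / 2
n≤triangle zero    = z≤n
n≤triangle (suc n) = begin
  suc n                    ≡⟨ m*n/n≡m (suc n) 2 ⟨
  (suc n * 2) / 2          ≤⟨ /-monoˡ-≤ 2 (*-monoʳ-≤ (suc n) (s≤s (s≤s (z≤n {n})))) ⟩
  (suc n * suc (suc n)) / 2 ∎
  where open ≤-Reasoning

g-≥ : ∀ m e → 2 ≤ m → 1 ≤ e → m ≤ g m e
g-≥ (suc a) e (s≤s 1≤a) 1≤e = +-mono-≤ (*-mono-≤ 1≤a 1≤e) (n≤triangle a)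

*≤g : ∀ m e → e ≤ m ∸ 1 → m * e ≤ g m e
*≤g zero    e _   = z≤n
*≤g (suc a) e e≤a = subst (_≤ g (suc a) e) (+-comm (a * e) e) (+-monoʳ-≤ (a * e) (≤-trans e≤a (n≤triangle a)))

g≤² : ∀ m e → 2 * e < m → g m e ≤ m * m
g≤² (suc a) e (s≤s 2e≤a) = *-cancelˡ-≤ 2 (begin
  2 * (a * e + H)      ≡⟨ *-distribˡ-+ 2 (a * e) H ⟩
  2 * (a * e) + 2 * H  ≤⟨ +-mono-≤ twice-ae twice-H ⟩
  M * M + M * M        ≡⟨ cong (M * M +_) (+-identityʳ (M * M)) ⟨
  2 * (M * M)          ∎)
  where
    open ≤-Reasoning
    M H : ℕ
    M = suc a
    H = (a * M) / 2
    aM≤MM : a * M ≤ M * M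
    aM≤MM = *-monoˡ-≤ M (n≤1+n a)
    twice-ae : 2 * (a * e) ≤ M * M
    twice-ae = begin
      2 * (a * e)  ≡⟨ *-assoc 2 a e ⟨
      2 * a * e    ≡⟨ cong (_* e) (*-comm 2 a) ⟩
      a * 2 * e    ≡⟨ *-assoc a 2 e ⟩
      a * (2 * e)  ≤⟨ *-monoʳ-≤ a (≤-trans 2e≤a (n≤1+n a)) ⟩
      a * M        ≤⟨ aM≤MM ⟩
      M * M        ∎
    twice-H : 2 * H ≤ M * M
    twice-H = ≤-trans (≤-reflexive (*-comm 2 H)) (≤-trans (m/n*n≤m (a * M) 2) aM≤MM)

gbar-≥ : ∀ x k i → 1 ≤ k → x + k + 1 ≤ gbar x k i
gbar-≥ x k zero    _   = ≤-refl
gbar-≥ x k (suc i) 1≤k = ≤-trans (gbar-≥ x k i 1≤k) (g-≥ _ _ 2≤gbar (1≤e-inv 1≤k))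
  where
    2≤gbar : 2 ≤ gbar x k i
    2≤gbar = ≤-trans (+-monoˡ-≤ 1 (≤-trans 1≤k (m≤n+m k x))) (gbar-≥ x k i 1≤k)

gbar-≤ : ∀ i x k → 0 < k → k ≤ x → gbar x k i ≤ (x + k + i + 1) ^ (2 ^ i)
gbar-≤ zero    x k _   _   = ≤-reflexive (sym (trans (*-identityʳ _) (cong (_+ 1) (+-identityʳ (x + k)))))
gbar-≤ (suc i) x k 0<k k≤x = begin
  g m e                  ≤⟨ g≤² m e 2e<m ⟩
  m * m                  ≤⟨ *-mono-≤ m≤Bᵖ m≤Bᵖ ⟩
  B ^ p * B ^ p          ≡⟨ ^-distribˡ-+-* B p p ⟨
  B ^ (p + p)            ≡⟨ cong (λ n → B ^ (p + n)) (+-identityʳ p) ⟨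
  B ^ (2 ^ suc i)        ∎
  where
    open ≤-Reasoning
    m e p B : ℕ
    m = gbar x k i
    e = e-inv k
    p = 2 ^ i
    B = x + k + suc i + 1
    m≤Bᵖ : m ≤ B ^ p
    m≤Bᵖ = ≤-trans (gbar-≤ i x k 0<k k≤x) (^-monoˡ-≤ p (+-monoˡ-≤ 1 (+-monoʳ-≤ (x + k) (n≤1+n i))))
    2e≤x+k : 2 * e ≤ x + k
    2e≤x+k = begin
      2 * e        ≤⟨ *-monoʳ-≤ 2 (e-inv≤ k) ⟩
      k + (k + 0)  ≡⟨ cong (k +_) (+-identityʳ k) ⟩
      k + k        ≤⟨ +-monoˡ-≤ k k≤x ⟩
      x + k        ∎
    2e<m : 2 * e < m
    2e<m = ≤-trans (s≤s 2e≤x+k) (≤-trans (≤-reflexive (+-comm 1 (x + k))) (gbar-≥ x k i 0<k))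

large⇒persistent : ∀ i k → 1 ≤ k → ∀ X → X ≢ [] → Increasing X → gbar (minL X) k i < length X → Persistent k i X
large⇒persistent _       _ _   []          X≢[] _     _     = ⊥-elim (X≢[] refl)
large⇒persistent zero    k _   X@(_ ∷ _)  _    _     large = ≤-<-trans (≤-trans (m≤m+n _ k) (m≤m+n _ 1)) large
large⇒persistent (suc i) k 1≤k X@(_ ∷ _)  _    X-inc large =
  Y , Y-inc , strided-⊆ e m , large⇒persistent i k 1≤k Y (λ ()) Y-inc Y-large ,
  λ T (T-tree , T-levels , T-splits) C →
    homogeneous-subtree C X-inc T-splits {m = m} (1≤e-inv 1≤k) (<2^e-inv k) me<X T-tree (T-levels (here refl))
  where
    e m : ℕ
    e = e-inv k
    m = gbar (minL X) k i
    Y : List ℕ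
    Y = strided e m X
    e≤m∸1 : e ≤ m ∸ 1
    e≤m∸1 = begin
      e                        ≤⟨ e-inv≤ k ⟩
      k                        ≤⟨ m≤n+m k (minL X) ⟩
      minL X + k               ≡⟨ m+n∸n≡m (minL X + k) 1 ⟨
      minL X + k + 1 ∸ 1       ≤⟨ ∸-monoˡ-≤ 1 (gbar-≥ (minL X) k i 1≤k) ⟩
      m ∸ 1                    ∎
      where open ≤-Reasoning
    me<X : m * e < length X
    me<X = ≤-<-trans (*≤g m e e≤m∸1) large
    Y-inc : Increasing Y
    Y-inc = strided-increasing (1≤e-inv 1≤k) m X-inc
    Y-large : gbar (minL Y) k i < length Y
    Y-large = subst₂ (λ a b → gbar a k i < b) (trans (minL-increasing X-inc) (sym (minL-increasing Y-inc)))
                     (sym (length-strided e m X me<X)) (n<1+n m)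

lemma2p7 : (i : ℕ) →
    ((x k : ℕ) → 0 < k → k ≤ x → gbar x k i ≤ (x + k + i + 1) ^ (2 ^ i)) ×
    ((k : ℕ) → 1 ≤ k → (X : List ℕ) → X ≢ [] → Increasing X →
       gbar (minL X) k i < length X → Persistent k i X)
lemma2p7 i = gbar-≤ i , large⇒persistent i
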